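{- Let $\alpha$ be an io-disjoint FLIF expression over a schema $\mathcal S$. There exists an $I(\alpha)$-executable FO formula $\varphi_\alpha$ over $\mathcal S$ with $\mathrm{FV}(\varphi_\alpha)=\mathrm{vars}(\alpha)$, whose length is linear in the length of $\alpha$, such that for every instance $D$ and every valuation $\nu_{\rm in}$ on $I(\alpha)$, \[\mathrm{Eval}_\alpha(D,\nu_{\rm in})=\mathrm{Eval}_{\varphi_\alpha,I(\alpha)}(D,\nu_{\rm in}).\] Here $\mathrm{Eval}_\alpha(D,\nu_{\rm in})=\{\nu_{\rm out}|_{\mathrm{vars}(\alpha)}\mid \exists\nu_{\rm in}'\supseteq\nu_{\rm in}\text{ with }(\nu_{\rm in}',\nu_{\rm out})\in[\![\alpha]\!]_D\}$, and $\mathrm{Eval}_{\varphi,V}(D,\nu_{\rm in})$ is the set of all valuations $\nu$ on $V\cup\mathrm{FV}(\varphi)$ with $\nu_{\rm in}\subseteq\nu$ and $D,\nu\models\varphi$.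
   Context: Fix a countably infinite set $\mathbf{dom}$ of constants and the set $\mathcal U$ of all variables. A schema $\mathcal S$ is a finite set of relation names $R$ with arity $\mathrm{ar}(R)$ and input arity $\mathrm{iar}(R)\le\mathrm{ar}(R)$; $\mathrm{oar}(R)=\mathrm{ar}(R)-\mathrm{iar}(R)$. An instance $D$ assigns each $R$ a relation $D(R)\subseteq\mathbf{dom}^{\mathrm{ar}(R)}$. Valuations on a set $X$ are maps $X\to\mathbf{dom}$; $\nu(c)=c$ for constants; $\nu[x:=c]$ is $\nu$ changed at $x$. FLIF expressions: atomic $R(\bar x;\bar y)$ ($\bar x$ of length $\mathrm{iar}(R)$, $\bar y$ of length $\mathrm{oar}(R)$), $(x=y)$, $(x=c)$, $(x:=y)$, $(x:=c)$; closed under $;$, $\cup$, $-$. $\mathrm{vars}(\alpha)$ is the set of variables occurring in $\alpha$. Semantics $[\![\alpha]\!]_D$ (pairs of valuations on $\mathcal U$): $R(\bar x;\bar y)$: $(\nu_1,\nu_2)$ with $\nu_1(\bar x)\cdot\nu_2(\bar y)\in D(R)$ and $\nu_1,\nu_2$ agreeing outside the variables of $\bar y$; $(x=y)$: $(\nu,\nu)$ with $\nu(x)=\nu(y)$; $(x=c)$: $(\nu,\nu)$ with $\nu(x)=c$; $(x:=y)$: $(\nu,\nu[x:=\nu(y)])$; $(x:=c)$: $(\nu,\nu[x:=c])$; $;$ relational composition, $\cup,-$ union and difference. Input/output variables: $I(R(\bar x;\bar y))=X$, $O=Y$ (variables of $\bar x$, $\bar y$); $I(x=y)=\{x,y\}$,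 $O=\emptyset$; $I(x:=y)=\{y\}$, $O=\{x\}$; $I(x=c)=\{x\}$, $O=\emptyset$; $I(x:=c)=\emptyset$, $O=\{x\}$; $I(\alpha_1;\alpha_2)=I(\alpha_1)\cup(I(\alpha_2)\setminus O(\alpha_1))$, $O=O(\alpha_1)\cup O(\alpha_2)$; $I(\alpha_1\cup\alpha_2)=I(\alpha_1)\cup I(\alpha_2)\cup(O(\alpha_1)\triangle O(\alpha_2))$, $O=O(\alpha_1)\cup O(\alpha_2)$; $I(\alpha_1-\alpha_2)=I(\alpha_1)\cup I(\alpha_2)\cup(O(\alpha_1)\triangle O(\alpha_2))$, $O=O(\alpha_1)$. io-disjoint: $I(\beta)\cap O(\beta)=\emptyset$ for every subexpression $\beta$ (including itself). FO formulas over $\mathcal S$: relation atoms $R(\bar x;\bar y)$, equalities $x=y$, $x=c$, and $\neg,\wedge,\vee,\exists$, natural semantics over $\mathbf{dom}$. $V$-executability: $x=y$ if $x\in V$ or $y\in V$; $x=c$ always; $R(\bar x;\bar y)$ if the variables of $\bar x$ lie in $V$; $\neg\varphi$ if $\varphi$ is and $\mathrm{FV}(\varphi)\subseteq V$; $\varphi\wedge\psi$ if $\varphi$ is $V$-executable and $\psi$ is $(V\cup\mathrm{FV}(\varphi))$-executable; $\varphi\vee\psi$ if both are $V$-executable and $\mathrm{FV}(\varphi)\triangle\mathrm{FV}(\psi)\subseteq V$; $\exists x\,\varphi$ if $\varphi$ is $(V\setminus\{x\})$-executable. -}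

module Defs where

open import Data.Nat using (ℕ; suc; _+_; _*_; _≤_)
open import Data.Fin using (Fin)
open import Data.Vec using (Vec; map; _++_)
open import Data.Vec.Membership.Propositional using (_∈_)
open import Data.Product using (Σ; ∃; _×_; _,_)
open import Data.Sum using (_⊎_)
open import Data.Empty using (⊥)
open import Relation.Nullary using (¬_; Dec; yes; no)
open import Relation.Binary.PropositionalEquality using (_≡_)
open import Data.Nat using (_≟_)

Dom : Set
Dom = ℕ

Var : Set
Var = ℕ

-- Valuations on 𝒰 (total).  A valuation on a subset X is represented by
-- a total valuation, of which only the values on X are relevant.
Val : Set
Val = Var → Dom

_[_≔_] : Val → Var → Dom → Val
(ν [ x ≔ c ]) z with z ≟ x
... | yes _ = c
... | no  _ = ν z

VarSet : Set₁
VarSet = Var → Set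

_∪_ : VarSet → VarSet → VarSet
(A ∪ B) x = A x ⊎ B x

_∖_ : VarSet → VarSet → VarSet
(A ∖ B) x = A x × ¬ B x

_△_ : VarSet → VarSet → VarSet
A △ B = (A ∖ B) ∪ (B ∖ A)

∅ : VarSet
∅ _ = ⊥

⟨_⟩ : Var → VarSet
⟨ x ⟩ z = z ≡ x

⟨_∣_⟩ : Var → Var → VarSet
⟨ x ∣ y ⟩ = ⟨ x ⟩ ∪ ⟨ y ⟩

vecSet : ∀ {n} → Vec Var n → VarSet
vecSet v z = z ∈ v

_⊆_ : VarSet → VarSet → Set
A ⊆ B = ∀ x → A x → B x

_≐_ : VarSet → VarSet → Set
A ≐ B = (A ⊆ B) × (B ⊆ A)

Agree : VarSet → Val → Val → Set
Agree X ν μ = ∀ x → X x → ν x ≡ μ x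

record Schema : Set where
  field
    n   : ℕ
    iar : Fin n → ℕ
    oar : Fin n → ℕ
  ar : Fin n → ℕ
  ar R = iar R + oar R
open Schema public

Instance : Schema → Set₁
Instance S = (R : Fin (n S)) → Vec Dom (ar S R) → Set

data FLIF (S : Schema) : Set where
  atom  : (R : Fin (n S)) → Vec Var (iar S R) → Vec Var (oar S R) → FLIF S
  eqv   : Var → Var → FLIF S
  eqc   : Var → Dom → FLIF S
  asgv  : Var → Var → FLIF S
  asgc  : Var → Dom → FLIF S
  _⨾_   : FLIF S → FLIF S → FLIF S
  _∪ᶠ_  : FLIF S → FLIF S → FLIF S
  _−ᶠ_  : FLIF S → FLIF S → FLIF S

module _ {S : Schema} where

  ⟦_⟧ : FLIF S → Instance S → Val → Val → Set
  ⟦ atom R xs ys ⟧ D ν₁ ν₂ =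
    D R (map ν₁ xs ++ map ν₂ ys) × (∀ z → ¬ (z ∈ ys) → ν₁ z ≡ ν₂ z)
  ⟦ eqv x y ⟧ D ν₁ ν₂ = (∀ z → ν₁ z ≡ ν₂ z) × ν₁ x ≡ ν₁ y
  ⟦ eqc x c ⟧ D ν₁ ν₂ = (∀ z → ν₁ z ≡ ν₂ z) × ν₁ x ≡ c
  ⟦ asgv x y ⟧ D ν₁ ν₂ = ∀ z → ν₂ z ≡ (ν₁ [ x ≔ ν₁ y ]) z
  ⟦ asgc x c ⟧ D ν₁ ν₂ = ∀ z → ν₂ z ≡ (ν₁ [ x ≔ c ]) z
  ⟦ α ⨾ β ⟧ D ν₁ ν₂ = ∃ λ ν → ⟦ α ⟧ D ν₁ ν × ⟦ β ⟧ D ν ν₂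
  ⟦ α ∪ᶠ β ⟧ D ν₁ ν₂ = ⟦ α ⟧ D ν₁ ν₂ ⊎ ⟦ β ⟧ D ν₁ ν₂
  ⟦ α −ᶠ β ⟧ D ν₁ ν₂ = ⟦ α ⟧ D ν₁ ν₂ × ¬ ⟦ β ⟧ D ν₁ ν₂

  vars : FLIF S → VarSet
  vars (atom R xs ys) = vecSet xs ∪ vecSet ys
  vars (eqv x y) = ⟨ x ∣ y ⟩
  vars (eqc x c) = ⟨ x ⟩
  vars (asgv x y) = ⟨ x ∣ y ⟩
  vars (asgc x c) = ⟨ x ⟩
  vars (α ⨾ β) = vars α ∪ vars β
  vars (α ∪ᶠ β) = vars α ∪ vars β
  vars (α −ᶠ β) = vars α ∪ vars β

  O : FLIF S → VarSet
  O (atom R xs ys) = vecSet ys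
  O (eqv x y) = ∅
  O (eqc x c) = ∅
  O (asgv x y) = ⟨ x ⟩
  O (asgc x c) = ⟨ x ⟩
  O (α ⨾ β) = O α ∪ O β
  O (α ∪ᶠ β) = O α ∪ O β
  O (α −ᶠ β) = O α

  I : FLIF S → VarSet
  I (atom R xs ys) = vecSet xs
  I (eqv x y) = ⟨ x ∣ y ⟩
  I (eqc x c) = ⟨ x ⟩
  I (asgv x y) = ⟨ y ⟩
  I (asgc x c) = ∅
  I (α ⨾ β) = I α ∪ (I β ∖ O α)
  I (α ∪ᶠ β) = (I α ∪ I β) ∪ (O α △ O β)
  I (α −ᶠ β) = (I α ∪ I β) ∪ (O α △ O β)

  Disj : FLIF S → Set
  Disj α = ∀ x → ¬ (I α x × O α x)

  IoDisjoint : FLIF S → Set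
  IoDisjoint (α ⨾ β) = Disj (α ⨾ β) × IoDisjoint α × IoDisjoint β
  IoDisjoint (α ∪ᶠ β) = Disj (α ∪ᶠ β) × IoDisjoint α × IoDisjoint β
  IoDisjoint (α −ᶠ β) = Disj (α −ᶠ β) × IoDisjoint α × IoDisjoint β
  IoDisjoint α = Disj α

  lengthᶠ : FLIF S → ℕ
  lengthᶠ (atom R xs ys) = suc (iar S R + oar S R)
  lengthᶠ (eqv x y) = 3
  lengthᶠ (eqc x c) = 3
  lengthᶠ (asgv x y) = 3
  lengthᶠ (asgc x c) = 3
  lengthᶠ (α ⨾ β) = suc (lengthᶠ α + lengthᶠ β)
  lengthᶠ (α ∪ᶠ β) = suc (lengthᶠ α + lengthᶠ β)
  lengthᶠ (α −ᶠ β) = suc (lengthᶠ α + lengthᶠ β)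

  -- Eval_α(D, ν_in), as a predicate on valuations μ (representing the
  -- valuation μ|vars(α)).
  EvalFLIF : FLIF S → Instance S → Val → Val → Set
  EvalFLIF α D νin μ =
    ∃ λ νin′ → ∃ λ νout →
      Agree (I α) νin νin′ × ⟦ α ⟧ D νin′ νout × Agree (vars α) νout μ

data FO (S : Schema) : Set where
  rel  : (R : Fin (n S)) → Vec Var (iar S R) → Vec Var (oar S R) → FO S
  eqv  : Var → Var → FO S
  eqc  : Var → Dom → FO S
  ¬ᶠ_  : FO S → FO S
  _∧ᶠ_ : FO S → FO S → FO S
  _∨ᶠ_ : FO S → FO S → FO S
  ∃ᶠ   : Var → FO S → FO S

module _ {S : Schema} where

  _⊢_⊨_ : Instance S → Val → FO S → Set
  D ⊢ ν ⊨ rel R xs ys = D R (map ν xs ++ map ν ys)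
  D ⊢ ν ⊨ eqv x y = ν x ≡ ν y
  D ⊢ ν ⊨ eqc x c = ν x ≡ c
  D ⊢ ν ⊨ (¬ᶠ φ) = ¬ (D ⊢ ν ⊨ φ)
  D ⊢ ν ⊨ (φ ∧ᶠ ψ) = (D ⊢ ν ⊨ φ) × (D ⊢ ν ⊨ ψ)
  D ⊢ ν ⊨ (φ ∨ᶠ ψ) = (D ⊢ ν ⊨ φ) ⊎ (D ⊢ ν ⊨ ψ)
  D ⊢ ν ⊨ ∃ᶠ x φ = ∃ λ c → D ⊢ (ν [ x ≔ c ]) ⊨ φ

  FV : FO S → VarSet
  FV (rel R xs ys) = vecSet xs ∪ vecSet ys
  FV (eqv x y) = ⟨ x ∣ y ⟩
  FV (eqc x c) = ⟨ x ⟩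
  FV (¬ᶠ φ) = FV φ
  FV (φ ∧ᶠ ψ) = FV φ ∪ FV ψ
  FV (φ ∨ᶠ ψ) = FV φ ∪ FV ψ
  FV (∃ᶠ x φ) = FV φ ∖ ⟨ x ⟩

  Exec : VarSet → FO S → Set
  Exec V (rel R xs ys) = vecSet xs ⊆ V
  Exec V (eqv x y) = V x ⊎ V y
  Exec V (eqc x c) = Data.Unit.⊤
    where import Data.Unit
  Exec V (¬ᶠ φ) = Exec V φ × FV φ ⊆ V
  Exec V (φ ∧ᶠ ψ) = Exec V φ × Exec (V ∪ FV φ) ψ
  Exec V (φ ∨ᶠ ψ) = Exec V φ × Exec V ψ × (FV φ △ FV ψ) ⊆ V
  Exec V (∃ᶠ x φ) = Exec (V ∖ ⟨ x ⟩) φ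

  lengthᵠ : FO S → ℕ
  lengthᵠ (rel R xs ys) = suc (iar S R + oar S R)
  lengthᵠ (eqv x y) = 3
  lengthᵠ (eqc x c) = 3
  lengthᵠ (¬ᶠ φ) = suc (lengthᵠ φ)
  lengthᵠ (φ ∧ᶠ ψ) = suc (lengthᵠ φ + lengthᵠ ψ)
  lengthᵠ (φ ∨ᶠ ψ) = suc (lengthᵠ φ + lengthᵠ ψ)
  lengthᵠ (∃ᶠ x φ) = 2 + lengthᵠ φ

  -- Eval_{φ,V}(D, ν_in), as a predicate on valuations μ (representing
  -- μ restricted to V ∪ FV(φ)).
  EvalFO : FO S → VarSet → Instance S → Val → Val → Set
  EvalFO φ V D νin μ = Agree V νin μ × (D ⊢ μ ⊨ φ)

-- Translate by structural recursion: α ⨾ β becomes (∃ O(α) ∩ O(β). φα) ∧ φβ, where the quantifier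
-- hides the intermediate values that β overwrites; α ∪ β becomes φα ∨ φβ, α − β becomes φα ∧ ¬ φβ,
-- and assignments become equalities. The invariant is that for every ν agreeing with μ on I(α),
-- μ satisfies φα exactly when some run of α from ν ends in a valuation agreeing with μ on vars(α).
-- A run changes only output variables and io-disjointness keeps inputs out of the outputs, which is
-- what transports agreement between the start of a run, its end and μ. For the length the invariant
-- is lengthᵠ φα + 2·|outs α| ≤ 3·lengthᶠ α, where outs α lists O(α): the quantifiers of α ⨾ β are
-- paid for by the variables of O(α) ∩ O(β), which outs (α ⨾ β) lists once instead of twice.

module Submission where

open import Defs
open import Data.Nat using (ℕ; suc; _+_; _*_; _≤_; _≟_)
open import Data.Nat.Properties using (*-monoʳ-≤; +-mono-≤; +-monoʳ-≤; +-monoˡ-≤; +-suc; m≤m+n; m≤n+m; ≤-trans; ≤-reflexive; module ≤-Reasoning)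
open import Data.Nat.Tactic.RingSolver using (solve-∀)
open import Data.Bool using (if_then_else_)
open import Data.Product using (Σ; ∃; _×_; _,_; proj₁; proj₂)
open import Data.Sum using (_⊎_; inj₁; inj₂)
import Data.Sum
open import Data.Empty using (⊥-elim)
open import Data.Unit using (tt)
open import Data.List using (List; []; _∷_; length; filter) renaming (_++_ to _++ˡ_)
open import Data.List.Properties using (length-++)
open import Data.List.Membership.DecPropositional _≟_ using (_∈_; _∈?_; _∉?_)
open import Data.List.Membership.Propositional.Properties using (∈-filter⁺; ∈-filter⁻; ∈-++⁺ˡ; ∈-++⁺ʳ; ∈-++⁻)
open import Data.List.Relation.Unary.Any using (here; there)
open import Data.Vec as Vec using (Vec; toList)
open import Data.Vec.Properties using (length-toList)
open import Data.Vec.Membership.DecPropositional _≟_ using () renaming (_∈?_ to _∈ᵛ?_)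
open import Data.Vec.Membership.Propositional.Properties using (∈-toList⁺; ∈-toList⁻)
import Data.Vec.Relation.Unary.Any as VecAny
open import Function.Base using (id)
open import Function.Bundles using (_⇔_; mk⇔)
open import Relation.Nullary using (¬_; yes; no; does; map′)
open import Relation.Unary using (∁; Decidable)
open import Relation.Binary.PropositionalEquality using (_≡_; _≢_; _≗_; refl; sym; trans; cong; cong₂; subst)

update-≡ : ∀ (ν : Val) x c → (ν [ x ≔ c ]) x ≡ c
update-≡ ν x c with x ≟ x
... | yes _ = refl
... | no x≢x = ⊥-elim (x≢x refl)

update-≢ : ∀ {ν : Val} {x c z} → z ≢ x → (ν [ x ≔ c ]) z ≡ ν z
update-≢ {x = x} {z = z} z≢x with z ≟ x
... | yes z≡x = ⊥-elim (z≢x z≡x)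
... | no _ = refl

update-source : ∀ (ν : Val) x y → (ν [ x ≔ ν y ]) y ≡ ν y
update-source ν x y with y ≟ x
... | yes _ = refl
... | no _ = refl

update-cong : ∀ {ν μ : Val} x c → ν ≗ μ → ν [ x ≔ c ] ≗ μ [ x ≔ c ]
update-cong x c ν≗μ z with z ≟ x
... | yes _ = refl
... | no _ = ν≗μ z

override : {P : VarSet} → Decidable P → Val → Val → Val
override P? μ ν z = if does (P? z) then μ z else ν z

override-∈ : ∀ {P : VarSet} (P? : Decidable P) μ ν {z} → P z → override P? μ ν z ≡ μ z
override-∈ P? μ ν {z} p with P? z
... | yes _ = refl
... | no ¬p = ⊥-elim (¬p p)

override-∉ : ∀ {P : VarSet} (P? : Decidable P) μ ν {z} → ¬ P z → override P? μ ν z ≡ ν z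
override-∉ P? μ ν {z} ¬p with P? z
... | yes p = ⊥-elim (¬p p)
... | no _ = refl

map-agree : ∀ {k} {ν μ : Val} (xs : Vec Var k) → Agree (vecSet xs) ν μ → Vec.map ν xs ≡ Vec.map μ xs
map-agree Vec.[] _ = refl
map-agree (x Vec.∷ xs) ag =
  cong₂ Vec._∷_ (ag x (VecAny.here refl)) (map-agree xs (λ z m → ag z (VecAny.there m)))

Agree-∪ : ∀ {X Y : VarSet} {ν μ : Val} → Agree X ν μ → Agree Y ν μ → Agree (X ∪ Y) ν μ
Agree-∪ agX agY z = Data.Sum.[ agX z , agY z ]

_∩ˡ_ : List Var → List Var → List Var
xs ∩ˡ ys = filter (_∈? ys) xs

_∖ˡ_ : List Var → List Var → List Var
xs ∖ˡ ys = filter (_∉? ys) xs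

length-∩ˡ+∖ˡ : ∀ xs ys → length (xs ∩ˡ ys) + length (xs ∖ˡ ys) ≡ length xs
length-∩ˡ+∖ˡ [] ys = refl
length-∩ˡ+∖ˡ (x ∷ xs) ys with x ∈? ys
... | yes _ = cong suc (length-∩ˡ+∖ˡ xs ys)
... | no _ = trans (+-suc _ _) (cong suc (length-∩ˡ+∖ˡ xs ys))

_∪ˡ_ : List Var → List Var → List Var
xs ∪ˡ ys = (xs ∖ˡ ys) ++ˡ ys

∈-∪ˡ⁺ : ∀ {z} xs ys → z ∈ xs ⊎ z ∈ ys → z ∈ xs ∪ˡ ys
∈-∪ˡ⁺ xs ys (inj₂ z∈ys) = ∈-++⁺ʳ (xs ∖ˡ ys) z∈ys
∈-∪ˡ⁺ {z} xs ys (inj₁ z∈xs) with z ∈? ys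
... | yes z∈ys = ∈-++⁺ʳ (xs ∖ˡ ys) z∈ys
... | no z∉ys = ∈-++⁺ˡ (∈-filter⁺ (_∉? ys) z∈xs z∉ys)

∈-∪ˡ⁻ : ∀ {z} xs ys → z ∈ xs ∪ˡ ys → z ∈ xs ⊎ z ∈ ys
∈-∪ˡ⁻ xs ys z∈ with ∈-++⁻ (xs ∖ˡ ys) z∈
... | inj₁ z∈xs∖ys = inj₁ (proj₁ (∈-filter⁻ (_∉? ys) z∈xs∖ys))
... | inj₂ z∈ys = inj₂ z∈ys

potential-combine : ∀ {c p q} la lb → c ≤ 3 → p ≤ 3 * la → q ≤ 3 * lb → c + (p + q) ≤ 3 * suc (la + lb)
potential-combine la lb c≤3 p≤ q≤ =
  ≤-trans (+-mono-≤ c≤3 (+-mono-≤ p≤ q≤)) (≤-reflexive (regroup la lb))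
  where
  regroup : ∀ la lb → 3 + (3 * la + 3 * lb) ≡ 3 * suc (la + lb)
  regroup = solve-∀

seq-length-bound : ∀ Lα Lβ a b la lb s k → s + k ≡ a → Lα + 2 * a ≤ 3 * la → Lβ + 2 * b ≤ 3 * lb →
                   suc ((s * 2 + Lα) + Lβ) + 2 * (k + b) ≤ 3 * suc (la + lb)
seq-length-bound Lα Lβ _ b la lb s k refl hα hβ = begin
  suc ((s * 2 + Lα) + Lβ) + 2 * (k + b)   ≡⟨ regroup s k Lα Lβ b ⟩
  1 + ((Lα + 2 * (s + k)) + (Lβ + 2 * b)) ≤⟨ potential-combine la lb (m≤m+n 1 2) hα hβ ⟩
  3 * suc (la + lb)                       ∎
  where
  open ≤-Reasoning
  regroup : ∀ s k Lα Lβ b → suc ((s * 2 + Lα) + Lβ) + 2 * (k + b) ≡ 1 + ((Lα + 2 * (s + k)) + (Lβ + 2 * b))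
  regroup = solve-∀

union-length-bound : ∀ Lα Lβ a b la lb s k → s + k ≡ a → Lα + 2 * a ≤ 3 * la → Lβ + 2 * b ≤ 3 * lb →
                     suc (Lα + Lβ) + 2 * (k + b) ≤ 3 * suc (la + lb)
union-length-bound Lα Lβ a b la lb s k s+k≡a hα hβ =
  ≤-trans (+-monoˡ-≤ (2 * (k + b)) (+-monoʳ-≤ 1 (+-monoˡ-≤ Lβ (m≤n+m Lα (s * 2)))))
          (seq-length-bound Lα Lβ a b la lb s k s+k≡a hα hβ)

diff-length-bound : ∀ Lα Lβ a b la lb → Lα + 2 * a ≤ 3 * la → Lβ + 2 * b ≤ 3 * lb →
                    suc (Lα + suc Lβ) + 2 * a ≤ 3 * suc (la + lb)
diff-length-bound Lα Lβ a b la lb hα hβ = begin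
  suc (Lα + suc Lβ) + 2 * a         ≡⟨ regroup Lα Lβ a ⟩
  2 + ((Lα + 2 * a) + Lβ)           ≤⟨ +-monoʳ-≤ 2 (+-monoʳ-≤ (Lα + 2 * a) (m≤m+n Lβ (2 * b))) ⟩
  2 + ((Lα + 2 * a) + (Lβ + 2 * b)) ≤⟨ potential-combine la lb (m≤m+n 2 1) hα hβ ⟩
  3 * suc (la + lb)                 ∎
  where
  open ≤-Reasoning
  regroup : ∀ Lα Lβ a → suc (Lα + suc Lβ) + 2 * a ≡ 2 + ((Lα + 2 * a) + Lβ)
  regroup = solve-∀

module _ {S : Schema} where

  ⊨-resp-≗ : ∀ {D : Instance S} (φ : FO S) {ν μ : Val} → ν ≗ μ → D ⊢ ν ⊨ φ → D ⊢ μ ⊨ φ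
  ⊨-resp-≗ {D} (rel R xs ys) ν≗μ =
    subst (D R) (cong₂ Vec._++_ (map-agree xs (λ z _ → ν≗μ z)) (map-agree ys (λ z _ → ν≗μ z)))
  ⊨-resp-≗ (eqv x y) ν≗μ νx≡νy = trans (sym (ν≗μ x)) (trans νx≡νy (ν≗μ y))
  ⊨-resp-≗ (eqc x c) ν≗μ νx≡c = trans (sym (ν≗μ x)) νx≡c
  ⊨-resp-≗ (¬ᶠ φ) ν≗μ ¬ν⊨φ μ⊨φ = ¬ν⊨φ (⊨-resp-≗ φ (λ z → sym (ν≗μ z)) μ⊨φ)
  ⊨-resp-≗ (φ ∧ᶠ ψ) ν≗μ (ν⊨φ , ν⊨ψ) = ⊨-resp-≗ φ ν≗μ ν⊨φ , ⊨-resp-≗ ψ ν≗μ ν⊨ψ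
  ⊨-resp-≗ (φ ∨ᶠ ψ) ν≗μ (inj₁ ν⊨φ) = inj₁ (⊨-resp-≗ φ ν≗μ ν⊨φ)
  ⊨-resp-≗ (φ ∨ᶠ ψ) ν≗μ (inj₂ ν⊨ψ) = inj₂ (⊨-resp-≗ ψ ν≗μ ν⊨ψ)
  ⊨-resp-≗ (∃ᶠ x φ) ν≗μ (c , ν⊨φ) = c , ⊨-resp-≗ φ (update-cong x c ν≗μ) ν⊨φ

  Exec-mono : ∀ (φ : FO S) {V W : VarSet} → V ⊆ W → Exec V φ → Exec W φ
  Exec-mono (rel R xs ys) V⊆W ex z m = V⊆W z (ex z m)
  Exec-mono (eqv x y) V⊆W (inj₁ Vx) = inj₁ (V⊆W x Vx)
  Exec-mono (eqv x y) V⊆W (inj₂ Vy) = inj₂ (V⊆W y Vy)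
  Exec-mono (eqc x c) V⊆W ex = tt
  Exec-mono (¬ᶠ φ) V⊆W (ex , FV⊆V) = Exec-mono φ V⊆W ex , λ z f → V⊆W z (FV⊆V z f)
  Exec-mono (φ ∧ᶠ ψ) V⊆W (exφ , exψ) = Exec-mono φ V⊆W exφ , Exec-mono ψ V∪FV⊆W∪FV exψ
    where
    V∪FV⊆W∪FV : (_ ∪ FV φ) ⊆ (_ ∪ FV φ)
    V∪FV⊆W∪FV z (inj₁ v) = inj₁ (V⊆W z v)
    V∪FV⊆W∪FV z (inj₂ f) = inj₂ f
  Exec-mono (φ ∨ᶠ ψ) V⊆W (exφ , exψ , △⊆V) =
    Exec-mono φ V⊆W exφ , Exec-mono ψ V⊆W exψ , λ z d → V⊆W z (△⊆V z d)
  Exec-mono (∃ᶠ x φ) V⊆W ex = Exec-mono φ (λ z (v , z≢x) → V⊆W z v , z≢x) ex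

  ∃ᶠ⋆ : List Var → FO S → FO S
  ∃ᶠ⋆ [] φ = φ
  ∃ᶠ⋆ (w ∷ ws) φ = ∃ᶠ w (∃ᶠ⋆ ws φ)

  ⊨-∃ᶠ⋆⁻ : ∀ {D : Instance S} ws (φ : FO S) {μ} → D ⊢ μ ⊨ ∃ᶠ⋆ ws φ →
           ∃ λ μ′ → Agree (∁ (_∈ ws)) μ μ′ × D ⊢ μ′ ⊨ φ
  ⊨-∃ᶠ⋆⁻ [] φ {μ} μ⊨φ = μ , (λ _ _ → refl) , μ⊨φ
  ⊨-∃ᶠ⋆⁻ (w ∷ ws) φ (c , μ[w≔c]⊨) =
    let μ′ , agree , μ′⊨φ = ⊨-∃ᶠ⋆⁻ ws φ μ[w≔c]⊨
    in μ′ , (λ z z∉ → trans (sym (update-≢ (λ z≡w → z∉ (here z≡w)))) (agree z (λ z∈ → z∉ (there z∈)))) , μ′⊨φ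

  ⊨-∃ᶠ⋆⁺ : ∀ {D : Instance S} ws (φ : FO S) {μ μ′} → Agree (∁ (_∈ ws)) μ μ′ → D ⊢ μ′ ⊨ φ → D ⊢ μ ⊨ ∃ᶠ⋆ ws φ
  ⊨-∃ᶠ⋆⁺ [] φ agree μ′⊨φ = ⊨-resp-≗ φ (λ z → sym (agree z λ ())) μ′⊨φ
  ⊨-∃ᶠ⋆⁺ (w ∷ ws) φ {μ} {μ′} agree μ′⊨φ = μ′ w , ⊨-∃ᶠ⋆⁺ ws φ agree′ μ′⊨φ
    where
    agree′ : Agree (∁ (_∈ ws)) (μ [ w ≔ μ′ w ]) μ′
    agree′ z z∉ with z ≟ w
    ... | yes refl = refl
    ... | no z≢w = agree z λ { (here z≡w) → z≢w z≡w ; (there z∈) → z∉ z∈ }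

  FV-∃ᶠ⋆⁻ : ∀ ws (φ : FO S) → FV (∃ᶠ⋆ ws φ) ⊆ FV φ
  FV-∃ᶠ⋆⁻ [] φ z f = f
  FV-∃ᶠ⋆⁻ (w ∷ ws) φ z (f , _) = FV-∃ᶠ⋆⁻ ws φ z f

  FV-∃ᶠ⋆⁺ : ∀ ws (φ : FO S) {z} → FV φ z → ¬ z ∈ ws → FV (∃ᶠ⋆ ws φ) z
  FV-∃ᶠ⋆⁺ [] φ f _ = f
  FV-∃ᶠ⋆⁺ (w ∷ ws) φ f z∉ = FV-∃ᶠ⋆⁺ ws φ f (λ z∈ → z∉ (there z∈)) , λ z≡w → z∉ (here z≡w)

  Exec-∃ᶠ⋆ : ∀ ws (φ : FO S) {V : VarSet} → Exec (V ∖ (_∈ ws)) φ → Exec V (∃ᶠ⋆ ws φ)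
  Exec-∃ᶠ⋆ [] φ ex = Exec-mono φ (λ z → proj₁) ex
  Exec-∃ᶠ⋆ (w ∷ ws) φ ex =
    Exec-∃ᶠ⋆ ws φ (Exec-mono φ (λ z (v , z∉) → (v , λ z≡w → z∉ (here z≡w)) , λ z∈ → z∉ (there z∈)) ex)

  lengthᵠ-∃ᶠ⋆ : ∀ ws (φ : FO S) → lengthᵠ (∃ᶠ⋆ ws φ) ≡ length ws * 2 + lengthᵠ φ
  lengthᵠ-∃ᶠ⋆ [] φ = refl
  lengthᵠ-∃ᶠ⋆ (w ∷ ws) φ = cong (2 +_) (lengthᵠ-∃ᶠ⋆ ws φ)

  outs : FLIF S → List Var
  outs (atom R xs ys) = toList ys
  outs (eqv x y) = []
  outs (eqc x c) = []
  outs (asgv x y) = x ∷ []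
  outs (asgc x c) = x ∷ []
  outs (α ⨾ β) = outs α ∪ˡ outs β
  outs (α ∪ᶠ β) = outs α ∪ˡ outs β
  outs (α −ᶠ β) = outs α

  ∈-outs⁺ : ∀ (α : FLIF S) {z} → O α z → z ∈ outs α
  ∈-outs⁺ (atom R xs ys) o = ∈-toList⁺ o
  ∈-outs⁺ (asgv x y) refl = here refl
  ∈-outs⁺ (asgc x c) refl = here refl
  ∈-outs⁺ (α ⨾ β) (inj₁ o) = ∈-∪ˡ⁺ (outs α) (outs β) (inj₁ (∈-outs⁺ α o))
  ∈-outs⁺ (α ⨾ β) (inj₂ o) = ∈-∪ˡ⁺ (outs α) (outs β) (inj₂ (∈-outs⁺ β o))
  ∈-outs⁺ (α ∪ᶠ β) (inj₁ o) = ∈-∪ˡ⁺ (outs α) (outs β) (inj₁ (∈-outs⁺ α o))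
  ∈-outs⁺ (α ∪ᶠ β) (inj₂ o) = ∈-∪ˡ⁺ (outs α) (outs β) (inj₂ (∈-outs⁺ β o))
  ∈-outs⁺ (α −ᶠ β) o = ∈-outs⁺ α o

  ∈-outs⁻ : ∀ (α : FLIF S) {z} → z ∈ outs α → O α z
  ∈-outs⁻ (atom R xs ys) z∈ = ∈-toList⁻ z∈
  ∈-outs⁻ (asgv x y) (here z≡x) = z≡x
  ∈-outs⁻ (asgc x c) (here z≡x) = z≡x
  ∈-outs⁻ (α ⨾ β) z∈ = Data.Sum.map (∈-outs⁻ α) (∈-outs⁻ β) (∈-∪ˡ⁻ (outs α) (outs β) z∈)
  ∈-outs⁻ (α ∪ᶠ β) z∈ = Data.Sum.map (∈-outs⁻ α) (∈-outs⁻ β) (∈-∪ˡ⁻ (outs α) (outs β) z∈)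
  ∈-outs⁻ (α −ᶠ β) z∈ = ∈-outs⁻ α z∈

  O? : ∀ (α : FLIF S) → Decidable (O α)
  O? α z = map′ (∈-outs⁻ α) (∈-outs⁺ α) (z ∈? outs α)

  O⊆vars : ∀ (α : FLIF S) → O α ⊆ vars α
  O⊆vars (atom R xs ys) z o = inj₂ o
  O⊆vars (asgv x y) z o = inj₁ o
  O⊆vars (asgc x c) z o = o
  O⊆vars (α ⨾ β) z (inj₁ o) = inj₁ (O⊆vars α z o)
  O⊆vars (α ⨾ β) z (inj₂ o) = inj₂ (O⊆vars β z o)
  O⊆vars (α ∪ᶠ β) z (inj₁ o) = inj₁ (O⊆vars α z o)
  O⊆vars (α ∪ᶠ β) z (inj₂ o) = inj₂ (O⊆vars β z o)
  O⊆vars (α −ᶠ β) z o = inj₁ (O⊆vars α z o)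

  join⊆vars : ∀ (α β : FLIF S) → ((I α ∪ I β) ∪ (O α △ O β)) ⊆ (vars α ∪ vars β)

  I⊆vars : ∀ (α : FLIF S) → I α ⊆ vars α
  I⊆vars (atom R xs ys) z i = inj₁ i
  I⊆vars (eqv x y) z i = i
  I⊆vars (eqc x c) z i = i
  I⊆vars (asgv x y) z i = inj₂ i
  I⊆vars (α ⨾ β) z (inj₁ i) = inj₁ (I⊆vars α z i)
  I⊆vars (α ⨾ β) z (inj₂ (i , _)) = inj₂ (I⊆vars β z i)
  I⊆vars (α ∪ᶠ β) z i = join⊆vars α β z i
  I⊆vars (α −ᶠ β) z i = join⊆vars α β z i

  join⊆vars α β z (inj₁ (inj₁ i)) = inj₁ (I⊆vars α z i)
  join⊆vars α β z (inj₁ (inj₂ i)) = inj₂ (I⊆vars β z i)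
  join⊆vars α β z (inj₂ (inj₁ (o , _))) = inj₁ (O⊆vars α z o)
  join⊆vars α β z (inj₂ (inj₂ (o , _))) = inj₂ (O⊆vars β z o)

  vars⊆I∪O : ∀ (α : FLIF S) → vars α ⊆ (I α ∪ O α)
  vars⊆I∪O (atom R xs ys) z v = v
  vars⊆I∪O (eqv x y) z v = inj₁ v
  vars⊆I∪O (eqc x c) z v = inj₁ v
  vars⊆I∪O (asgv x y) z (inj₁ z≡x) = inj₂ z≡x
  vars⊆I∪O (asgv x y) z (inj₂ z≡y) = inj₁ z≡y
  vars⊆I∪O (asgc x c) z v = inj₂ v
  vars⊆I∪O (α ⨾ β) z (inj₁ v) = Data.Sum.map inj₁ inj₁ (vars⊆I∪O α z v)
  vars⊆I∪O (α ⨾ β) z (inj₂ v) with vars⊆I∪O β z v | O? α z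
  ... | inj₂ oβ | _ = inj₂ (inj₂ oβ)
  ... | inj₁ _ | yes oα = inj₂ (inj₁ oα)
  ... | inj₁ iβ | no ¬oα = inj₁ (inj₂ (iβ , ¬oα))
  vars⊆I∪O (α ∪ᶠ β) z (inj₁ v) = Data.Sum.map (λ i → inj₁ (inj₁ i)) inj₁ (vars⊆I∪O α z v)
  vars⊆I∪O (α ∪ᶠ β) z (inj₂ v) = Data.Sum.map (λ i → inj₁ (inj₂ i)) inj₂ (vars⊆I∪O β z v)
  vars⊆I∪O (α −ᶠ β) z (inj₁ v) = Data.Sum.map (λ i → inj₁ (inj₁ i)) id (vars⊆I∪O α z v)
  vars⊆I∪O (α −ᶠ β) z (inj₂ v) with vars⊆I∪O β z v | O? α z
  ... | inj₁ iβ | _ = inj₁ (inj₁ (inj₂ iβ))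
  ... | inj₂ _ | yes oα = inj₂ oα
  ... | inj₂ oβ | no ¬oα = inj₁ (inj₂ (inj₂ (oβ , ¬oα)))

  vars-outside : ∀ (α β : FLIF S) {z} → vars β z → ¬ O α z → (I β ∪ (O β ∖ O α)) z
  vars-outside α β {z} v ¬oα with vars⊆I∪O β z v
  ... | inj₁ iβ = inj₁ iβ
  ... | inj₂ oβ = inj₂ (oβ , ¬oα)

  join⊇ˡ : ∀ (α β : FLIF S) → (I α ∪ (O α ∖ O β)) ⊆ ((I α ∪ I β) ∪ (O α △ O β))
  join⊇ˡ α β z (inj₁ i) = inj₁ (inj₁ i)
  join⊇ˡ α β z (inj₂ o) = inj₂ (inj₁ o)

  join⊇ʳ : ∀ (α β : FLIF S) → (I β ∪ (O β ∖ O α)) ⊆ ((I α ∪ I β) ∪ (O α △ O β))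
  join⊇ʳ α β z (inj₁ i) = inj₁ (inj₂ i)
  join⊇ʳ α β z (inj₂ o) = inj₂ (inj₂ o)

  frame : ∀ (α : FLIF S) {D ν ν′ z} → ⟦ α ⟧ D ν ν′ → ¬ O α z → ν z ≡ ν′ z
  frame (atom R xs ys) {z = z} (_ , unchanged) ¬o = unchanged z ¬o
  frame (eqv x y) {z = z} (ν≗ν′ , _) _ = ν≗ν′ z
  frame (eqc x c) {z = z} (ν≗ν′ , _) _ = ν≗ν′ z
  frame (asgv x y) {z = z} ν′≗ ¬o = sym (trans (ν′≗ z) (update-≢ ¬o))
  frame (asgc x c) {z = z} ν′≗ ¬o = sym (trans (ν′≗ z) (update-≢ ¬o))
  frame (α ⨾ β) (_ , r₁ , r₂) ¬o = trans (frame α r₁ (λ o → ¬o (inj₁ o))) (frame β r₂ (λ o → ¬o (inj₂ o)))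
  frame (α ∪ᶠ β) (inj₁ r) ¬o = frame α r (λ o → ¬o (inj₁ o))
  frame (α ∪ᶠ β) (inj₂ r) ¬o = frame β r (λ o → ¬o (inj₂ o))
  frame (α −ᶠ β) (r , _) ¬o = frame α r ¬o

  ⟦⟧-respʳ-≗ : ∀ (α : FLIF S) {D ν ν₁ ν₂} → ⟦ α ⟧ D ν ν₁ → ν₁ ≗ ν₂ → ⟦ α ⟧ D ν ν₂
  ⟦⟧-respʳ-≗ (atom R xs ys) {D} {ν} (ν⊨R , unchanged) ν₁≗ν₂ =
    subst (λ out → D R (Vec.map ν xs Vec.++ out)) (map-agree ys (λ z _ → ν₁≗ν₂ z)) ν⊨R ,
    λ z z∉ → trans (unchanged z z∉) (ν₁≗ν₂ z)
  ⟦⟧-respʳ-≗ (eqv x y) (ν≗ν₁ , guard) ν₁≗ν₂ = (λ z → trans (ν≗ν₁ z) (ν₁≗ν₂ z)) , guard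
  ⟦⟧-respʳ-≗ (eqc x c) (ν≗ν₁ , guard) ν₁≗ν₂ = (λ z → trans (ν≗ν₁ z) (ν₁≗ν₂ z)) , guard
  ⟦⟧-respʳ-≗ (asgv x y) ν₁≗ ν₁≗ν₂ z = trans (sym (ν₁≗ν₂ z)) (ν₁≗ z)
  ⟦⟧-respʳ-≗ (asgc x c) ν₁≗ ν₁≗ν₂ z = trans (sym (ν₁≗ν₂ z)) (ν₁≗ z)
  ⟦⟧-respʳ-≗ (α ⨾ β) (ν′ , r₁ , r₂) ν₁≗ν₂ = ν′ , r₁ , ⟦⟧-respʳ-≗ β r₂ ν₁≗ν₂
  ⟦⟧-respʳ-≗ (α ∪ᶠ β) (inj₁ r) ν₁≗ν₂ = inj₁ (⟦⟧-respʳ-≗ α r ν₁≗ν₂)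
  ⟦⟧-respʳ-≗ (α ∪ᶠ β) (inj₂ r) ν₁≗ν₂ = inj₂ (⟦⟧-respʳ-≗ β r ν₁≗ν₂)
  ⟦⟧-respʳ-≗ (α −ᶠ β) (r , ¬r) ν₁≗ν₂ =
    ⟦⟧-respʳ-≗ α r ν₁≗ν₂ , λ r′ → ¬r (⟦⟧-respʳ-≗ β r′ (λ z → sym (ν₁≗ν₂ z)))

  IoDisjoint⇒Disj : ∀ (α : FLIF S) → IoDisjoint α → Disj α
  IoDisjoint⇒Disj (atom R xs ys) d = d
  IoDisjoint⇒Disj (eqv x y) d = d
  IoDisjoint⇒Disj (eqc x c) d = d
  IoDisjoint⇒Disj (asgv x y) d = d
  IoDisjoint⇒Disj (asgc x c) d = d
  IoDisjoint⇒Disj (α ⨾ β) (d , _) = d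
  IoDisjoint⇒Disj (α ∪ᶠ β) (d , _) = d
  IoDisjoint⇒Disj (α −ᶠ β) (d , _) = d

  Outcome : FLIF S → Instance S → Val → Val → Set
  Outcome α D ν μ = ∃ λ ν′ → ⟦ α ⟧ D ν ν′ × Agree (vars α) ν′ μ

  Agree-vars-extend : ∀ (α β : FLIF S) {D ν ν′ μ} → ⟦ α ⟧ D ν ν′ → Agree (vars α) ν′ μ →
                   Agree (I β ∪ (O β ∖ O α)) ν μ → Agree (vars β) ν′ μ
  Agree-vars-extend α β r agα ag z v with O? α z
  ... | yes oα = agα z (O⊆vars α z oα)
  ... | no ¬oα = trans (sym (frame α r ¬oα)) (ag z (vars-outside α β v ¬oα))

  record Translation (α : FLIF S) : Set₁ where
    field
      formula : FO S
      executable : Exec (I α) formula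
      FV-sound : FV formula ⊆ vars α
      FV-complete : vars α ⊆ FV formula
      length-bound : lengthᵠ formula + 2 * length (outs α) ≤ 3 * lengthᶠ α
      complete : ∀ D ν μ → Agree (I α) ν μ → Outcome α D ν μ → D ⊢ μ ⊨ formula
      sound : ∀ D ν μ → Agree (I α) ν μ → D ⊢ μ ⊨ formula → Outcome α D ν μ

  translate-atom : ∀ R xs ys → Translation (atom {S} R xs ys)
  translate-atom R xs ys = record
    { formula = rel R xs ys
    ; executable = λ z i → i
    ; FV-sound = λ z v → v
    ; FV-complete = λ z v → v
    ; length-bound =
        subst (λ k → size + 2 * k ≤ 3 * size) (sym (length-toList ys))
              (+-monoʳ-≤ size (*-monoʳ-≤ 2 (m≤n+m (oar S R) (suc (iar S R)))))
    ; complete = λ D ν μ ag (ν′ , (ν⊨R , _) , ag′) →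
        subst (D R) (cong₂ Vec._++_ (map-agree xs ag) (map-agree ys (λ z o → ag′ z (inj₂ o)))) ν⊨R
    ; sound = sound
    }
    where
    size : ℕ
    size = suc (iar S R + oar S R)
    sound : ∀ (D : Instance S) (ν μ : Val) → Agree (vecSet xs) ν μ → D ⊢ μ ⊨ rel {S} R xs ys → Outcome (atom R xs ys) D ν μ
    sound D ν μ ag μ⊨R = ν′ , (ν′⊨R , λ z z∉ → sym (override-∉ (_∈ᵛ? ys) μ ν z∉)) , agree
      where
      ν′ : Val
      ν′ = override (_∈ᵛ? ys) μ ν
      ν′⊨R : D R (Vec.map ν xs Vec.++ Vec.map ν′ ys)
      ν′⊨R = subst (D R) (cong₂ Vec._++_ (sym (map-agree xs ag))
                                         (sym (map-agree ys (λ z → override-∈ (_∈ᵛ? ys) μ ν)))) μ⊨R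
      agree : Agree (vecSet xs ∪ vecSet ys) ν′ μ
      agree z (inj₂ z∈ys) = override-∈ (_∈ᵛ? ys) μ ν z∈ys
      agree z (inj₁ z∈xs) with z ∈ᵛ? ys
      ... | yes _ = refl
      ... | no _ = ag z z∈xs

  translate-eqv : ∀ x y → Translation (eqv {S} x y)
  translate-eqv x y = record
    { formula = eqv x y
    ; executable = inj₁ (inj₁ refl)
    ; FV-sound = λ z v → v
    ; FV-complete = λ z v → v
    ; length-bound = m≤m+n 3 6
    ; complete = λ D ν μ ag (_ , (_ , νx≡νy) , _) →
        trans (sym (ag x (inj₁ refl))) (trans νx≡νy (ag y (inj₂ refl)))
    ; sound = λ D ν μ ag μx≡μy →
        ν , ((λ _ → refl) , trans (ag x (inj₁ refl)) (trans μx≡μy (sym (ag y (inj₂ refl))))) , ag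
    }

  translate-eqc : ∀ x c → Translation (eqc {S} x c)
  translate-eqc x c = record
    { formula = eqc x c
    ; executable = tt
    ; FV-sound = λ z v → v
    ; FV-complete = λ z v → v
    ; length-bound = m≤m+n 3 6
    ; complete = λ D ν μ ag (_ , (_ , νx≡c) , _) → trans (sym (ag x refl)) νx≡c
    ; sound = λ D ν μ ag μx≡c → ν , ((λ _ → refl) , trans (ag x refl) μx≡c) , ag
    }

  translate-asgv : ∀ x y → Translation (asgv {S} x y)
  translate-asgv x y = record
    { formula = eqv x y
    ; executable = inj₂ refl
    ; FV-sound = λ z v → v
    ; FV-complete = λ z v → v
    ; length-bound = m≤m+n 5 4
    ; complete = λ D ν μ ag (ν′ , ν′≗ , ag′) →
        trans (sym (ag′ x (inj₁ refl))) (trans (ν′≗ x) (trans (update-≡ ν x (ν y)) (ag y refl)))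
    ; sound = λ D ν μ ag μx≡μy → ν [ x ≔ ν y ] , (λ _ → refl) , agree ν μ ag μx≡μy
    }
    where
    agree : ∀ ν μ → Agree ⟨ y ⟩ ν μ → μ x ≡ μ y → Agree ⟨ x ∣ y ⟩ (ν [ x ≔ ν y ]) μ
    agree ν μ ag μx≡μy z (inj₁ refl) = trans (update-≡ ν x (ν y)) (trans (ag y refl) (sym μx≡μy))
    agree ν μ ag μx≡μy z (inj₂ refl) = trans (update-source ν x y) (ag y refl)

  translate-asgc : ∀ x c → Translation (asgc {S} x c)
  translate-asgc x c = record
    { formula = eqc x c
    ; executable = tt
    ; FV-sound = λ z v → v
    ; FV-complete = λ z v → v
    ; length-bound = m≤m+n 5 4
    ; complete = λ D ν μ ag (ν′ , ν′≗ , ag′) → trans (sym (ag′ x refl)) (trans (ν′≗ x) (update-≡ ν x c))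
    ; sound = λ D ν μ ag μx≡c → ν [ x ≔ c ] , (λ _ → refl) , λ { z refl → trans (update-≡ ν x c) (sym μx≡c) }
    }

  module Sequence {α β : FLIF S} (disj : Disj (α ⨾ β)) (disjα : Disj α) (disjβ : Disj β)
                  (Tα : Translation α) (Tβ : Translation β) where
    open Translation Tα renaming (formula to φα; executable to execα; FV-sound to FV-soundα;
      FV-complete to FV-completeα; length-bound to boundα; complete to completeα; sound to soundα)
    open Translation Tβ renaming (formula to φβ; executable to execβ; FV-sound to FV-soundβ;
      FV-complete to FV-completeβ; length-bound to boundβ; complete to completeβ; sound to soundβ)

    shared : List Var
    shared = outs α ∩ˡ outs β

    shared⁻ : ∀ {z} → z ∈ shared → O α z × O β z
    shared⁻ z∈ = let z∈α , z∈β = ∈-filter⁻ (_∈? outs β) z∈ in ∈-outs⁻ α z∈α , ∈-outs⁻ β z∈β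

    shared⁺ : ∀ {z} → O α z → O β z → z ∈ shared
    shared⁺ oα oβ = ∈-filter⁺ (_∈? outs β) (∈-outs⁺ α oα) (∈-outs⁺ β oβ)

    Iα-unshared : ∀ {z} → I α z → ¬ z ∈ shared
    Iα-unshared i z∈ = disjα _ (i , proj₁ (shared⁻ z∈))

    Iβ-unshared : ∀ {z} → I β z → ¬ z ∈ shared
    Iβ-unshared i z∈ = disjβ _ (i , proj₂ (shared⁻ z∈))

    unshared-not-Oβ : ∀ {z} → vars α z → ¬ z ∈ shared → ¬ O β z
    unshared-not-Oβ {z} v z∉ oβ with vars⊆I∪O α z v
    ... | inj₁ iα = disj z (inj₁ iα , inj₂ oβ)
    ... | inj₂ oα = z∉ (shared⁺ oα oβ)

    formula : FO S
    formula = ∃ᶠ⋆ shared φα ∧ᶠ φβ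

    executable : Exec (I (α ⨾ β)) formula
    executable = Exec-∃ᶠ⋆ shared φα (Exec-mono φα (λ z i → inj₁ i , Iα-unshared i) execα) ,
                 Exec-mono φβ Iβ⊆ execβ
      where
      Iβ⊆ : I β ⊆ (I (α ⨾ β) ∪ FV (∃ᶠ⋆ shared φα))
      Iβ⊆ z i with O? α z
      ... | yes oα = inj₂ (FV-∃ᶠ⋆⁺ shared φα (FV-completeα z (O⊆vars α z oα)) (Iβ-unshared i))
      ... | no ¬oα = inj₁ (inj₂ (i , ¬oα))

    FV-sound : FV formula ⊆ vars (α ⨾ β)
    FV-sound z (inj₁ f) = inj₁ (FV-soundα z (FV-∃ᶠ⋆⁻ shared φα z f))
    FV-sound z (inj₂ f) = inj₂ (FV-soundβ z f)

    FV-complete : vars (α ⨾ β) ⊆ FV formula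
    FV-complete z (inj₂ v) = inj₂ (FV-completeβ z v)
    FV-complete z (inj₁ v) with z ∈? shared
    ... | yes z∈ = inj₂ (FV-completeβ z (O⊆vars β z (proj₂ (shared⁻ z∈))))
    ... | no z∉ = inj₁ (FV-∃ᶠ⋆⁺ shared φα (FV-completeα z v) z∉)

    length-bound : lengthᵠ formula + 2 * length (outs (α ⨾ β)) ≤ 3 * lengthᶠ (α ⨾ β)
    length-bound = begin
      lengthᵠ formula + 2 * length (outs (α ⨾ β))
        ≡⟨ cong₂ (λ m n → suc (m + lengthᵠ φβ) + 2 * n) (lengthᵠ-∃ᶠ⋆ shared φα) (length-++ (outs α ∖ˡ outs β)) ⟩
      suc ((length shared * 2 + lengthᵠ φα) + lengthᵠ φβ) + 2 * (length (outs α ∖ˡ outs β) + length (outs β))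
        ≤⟨ seq-length-bound (lengthᵠ φα) (lengthᵠ φβ) (length (outs α)) (length (outs β)) (lengthᶠ α) (lengthᶠ β)
                             (length shared) _ (length-∩ˡ+∖ˡ (outs α) (outs β)) boundα boundβ ⟩
      3 * lengthᶠ (α ⨾ β) ∎
      where open ≤-Reasoning

    Iα-agree : ∀ {ν μ μ′} → Agree (I (α ⨾ β)) ν μ → Agree (∁ (_∈ shared)) μ μ′ → Agree (I α) ν μ′
    Iα-agree ag μ≈μ′ z i = trans (ag z (inj₁ i)) (μ≈μ′ z (Iα-unshared i))

    Iβ-agree : ∀ {D ν ν₁ μ} → ⟦ α ⟧ D ν ν₁ → Agree (I (α ⨾ β)) ν μ →
               (∀ z → O α z → I β z → ν₁ z ≡ μ z) → Agree (I β) ν₁ μ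
    Iβ-agree r₁ ag agOα z i with O? α z
    ... | yes oα = agOα z oα i
    ... | no ¬oα = trans (sym (frame α r₁ ¬oα)) (ag z (inj₂ (i , ¬oα)))

    complete : ∀ D ν μ → Agree (I (α ⨾ β)) ν μ → Outcome (α ⨾ β) D ν μ → D ⊢ μ ⊨ formula
    complete D ν μ ag (ν₂ , (ν₁ , r₁ , r₂) , ν₂≈μ) =
      ⊨-∃ᶠ⋆⁺ shared φα μ≈μ′ (completeα D ν μ′ (Iα-agree ag μ≈μ′) (ν₁ , r₁ , ν₁≈μ′)) ,
      completeβ D ν₁ μ (Iβ-agree r₁ ag ν₁≈μ-on-Iβ) (ν₂ , r₂ , λ z v → ν₂≈μ z (inj₂ v))
      where
      μ′ : Val
      μ′ = override (_∈? shared) ν₁ μ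
      μ≈μ′ : Agree (∁ (_∈ shared)) μ μ′
      μ≈μ′ z z∉ = sym (override-∉ (_∈? shared) ν₁ μ z∉)
      ν₁≈μ-on-Iβ : ∀ z → O α z → I β z → ν₁ z ≡ μ z
      ν₁≈μ-on-Iβ z oα iβ = trans (frame β r₂ (λ oβ → disjβ z (iβ , oβ))) (ν₂≈μ z (inj₁ (O⊆vars α z oα)))
      ν₁≈μ′ : Agree (vars α) ν₁ μ′
      ν₁≈μ′ z v with z ∈? shared
      ... | yes _ = refl
      ... | no z∉ = trans (frame β r₂ (unshared-not-Oβ v z∉)) (ν₂≈μ z (inj₁ v))

    final-agree : ∀ {D ν₁ ν₂ μ μ′} → ⟦ β ⟧ D ν₁ ν₂ → Agree (vars α) ν₁ μ′ → Agree (∁ (_∈ shared)) μ μ′ →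
                  Agree (vars β) ν₂ μ → Agree (vars (α ⨾ β)) ν₂ μ
    final-agree r₂ ν₁≈μ′ μ≈μ′ ν₂≈μ z (inj₂ v) = ν₂≈μ z v
    final-agree r₂ ν₁≈μ′ μ≈μ′ ν₂≈μ z (inj₁ v) with z ∈? shared
    ... | yes z∈ = ν₂≈μ z (O⊆vars β z (proj₂ (shared⁻ z∈)))
    ... | no z∉ = trans (sym (frame β r₂ (unshared-not-Oβ v z∉))) (trans (ν₁≈μ′ z v) (sym (μ≈μ′ z z∉)))

    sound : ∀ D ν μ → Agree (I (α ⨾ β)) ν μ → D ⊢ μ ⊨ formula → Outcome (α ⨾ β) D ν μ
    sound D ν μ ag (μ⊨∃φα , μ⊨φβ) =
      let μ′ , μ≈μ′ , μ′⊨φα = ⊨-∃ᶠ⋆⁻ shared φα μ⊨∃φα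
          ν₁ , r₁ , ν₁≈μ′ = soundα D ν μ′ (Iα-agree ag μ≈μ′) μ′⊨φα
          ν₁≈μ-on-Iβ z oα iβ = trans (ν₁≈μ′ z (O⊆vars α z oα)) (sym (μ≈μ′ z (Iβ-unshared iβ)))
          ν₂ , r₂ , ν₂≈μ = soundβ D ν₁ μ (Iβ-agree r₁ ag ν₁≈μ-on-Iβ) μ⊨φβ
      in ν₂ , (ν₁ , r₁ , r₂) , final-agree r₂ ν₁≈μ′ μ≈μ′ ν₂≈μ

    translation : Translation (α ⨾ β)
    translation = record
      { formula = formula ; executable = executable ; FV-sound = FV-sound ; FV-complete = FV-complete
      ; length-bound = length-bound ; complete = complete ; sound = sound }

  module Union {α β : FLIF S} (Tα : Translation α) (Tβ : Translation β) where
    open Translation Tα renaming (formula to φα; executable to execα; FV-sound to FV-soundα;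
      FV-complete to FV-completeα; length-bound to boundα; complete to completeα; sound to soundα)
    open Translation Tβ renaming (formula to φβ; executable to execβ; FV-sound to FV-soundβ;
      FV-complete to FV-completeβ; length-bound to boundβ; complete to completeβ; sound to soundβ)

    formula : FO S
    formula = φα ∨ᶠ φβ

    executable : Exec (I (α ∪ᶠ β)) formula
    executable = Exec-mono φα (λ z i → inj₁ (inj₁ i)) execα , Exec-mono φβ (λ z i → inj₁ (inj₂ i)) execβ , FV△⊆
      where
      FV△⊆ : (FV φα △ FV φβ) ⊆ I (α ∪ᶠ β)
      FV△⊆ z (inj₁ (fα , ∉fβ)) =
        join⊇ˡ α β z (vars-outside β α (FV-soundα z fα) (λ oβ → ∉fβ (FV-completeβ z (O⊆vars β z oβ))))
      FV△⊆ z (inj₂ (fβ , ∉fα)) =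
        join⊇ʳ α β z (vars-outside α β (FV-soundβ z fβ) (λ oα → ∉fα (FV-completeα z (O⊆vars α z oα))))

    length-bound : lengthᵠ formula + 2 * length (outs (α ∪ᶠ β)) ≤ 3 * lengthᶠ (α ∪ᶠ β)
    length-bound = begin
      lengthᵠ formula + 2 * length (outs (α ∪ᶠ β))
        ≡⟨ cong (λ n → lengthᵠ formula + 2 * n) (length-++ (outs α ∖ˡ outs β)) ⟩
      lengthᵠ formula + 2 * (length (outs α ∖ˡ outs β) + length (outs β))
        ≤⟨ union-length-bound (lengthᵠ φα) (lengthᵠ φβ) (length (outs α)) (length (outs β)) (lengthᶠ α) (lengthᶠ β)
                               (length (outs α ∩ˡ outs β)) _
             (length-∩ˡ+∖ˡ (outs α) (outs β)) boundα boundβ ⟩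
      3 * lengthᶠ (α ∪ᶠ β) ∎
      where open ≤-Reasoning

    complete : ∀ D ν μ → Agree (I (α ∪ᶠ β)) ν μ → Outcome (α ∪ᶠ β) D ν μ → D ⊢ μ ⊨ formula
    complete D ν μ ag (ν′ , inj₁ r , ν′≈μ) =
      inj₁ (completeα D ν μ (λ z i → ag z (inj₁ (inj₁ i))) (ν′ , r , λ z v → ν′≈μ z (inj₁ v)))
    complete D ν μ ag (ν′ , inj₂ r , ν′≈μ) =
      inj₂ (completeβ D ν μ (λ z i → ag z (inj₁ (inj₂ i))) (ν′ , r , λ z v → ν′≈μ z (inj₂ v)))

    sound : ∀ D ν μ → Agree (I (α ∪ᶠ β)) ν μ → D ⊢ μ ⊨ formula → Outcome (α ∪ᶠ β) D ν μ
    sound D ν μ ag (inj₁ μ⊨φα) =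
      let ν′ , r , ν′≈μ = soundα D ν μ (λ z i → ag z (inj₁ (inj₁ i))) μ⊨φα
      in ν′ , inj₁ r , Agree-∪ ν′≈μ (Agree-vars-extend α β r ν′≈μ (λ z x → ag z (join⊇ʳ α β z x)))
    sound D ν μ ag (inj₂ μ⊨φβ) =
      let ν′ , r , ν′≈μ = soundβ D ν μ (λ z i → ag z (inj₁ (inj₂ i))) μ⊨φβ
      in ν′ , inj₂ r , Agree-∪ (Agree-vars-extend β α r ν′≈μ (λ z x → ag z (join⊇ˡ α β z x))) ν′≈μ

    translation : Translation (α ∪ᶠ β)
    translation = record
      { formula = formula ; executable = executable
      ; FV-sound = λ z → Data.Sum.map (FV-soundα z) (FV-soundβ z)
      ; FV-complete = λ z → Data.Sum.map (FV-completeα z) (FV-completeβ z)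
      ; length-bound = length-bound ; complete = complete ; sound = sound }

  module Difference {α β : FLIF S} (disj : Disj (α −ᶠ β)) (Tα : Translation α) (Tβ : Translation β) where
    open Translation Tα renaming (formula to φα; executable to execα; FV-sound to FV-soundα;
      FV-complete to FV-completeα; length-bound to boundα; complete to completeα; sound to soundα)
    open Translation Tβ renaming (formula to φβ; executable to execβ; FV-sound to FV-soundβ;
      FV-complete to FV-completeβ; length-bound to boundβ; complete to completeβ; sound to soundβ)

    formula : FO S
    formula = φα ∧ᶠ (¬ᶠ φβ)

    executable : Exec (I (α −ᶠ β)) formula
    executable = Exec-mono φα (λ z i → inj₁ (inj₁ i)) execα ,
                 Exec-mono φβ (λ z i → inj₁ (inj₁ (inj₂ i))) execβ , FVβ⊆
      where
      FVβ⊆ : FV φβ ⊆ (I (α −ᶠ β) ∪ FV φα)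
      FVβ⊆ z fβ with O? α z
      ... | yes oα = inj₂ (FV-completeα z (O⊆vars α z oα))
      ... | no ¬oα = inj₁ (join⊇ʳ α β z (vars-outside α β (FV-soundβ z fβ) ¬oα))

    Oα⊆Oβ : O α ⊆ O β
    Oα⊆Oβ z oα with O? β z
    ... | yes oβ = oβ
    ... | no ¬oβ = ⊥-elim (disj z (join⊇ˡ α β z (inj₂ (oα , ¬oβ)) , oα))

    Iα-agree : ∀ {ν μ} → Agree (I (α −ᶠ β)) ν μ → Agree (I α) ν μ
    Iα-agree ag z i = ag z (inj₁ (inj₁ i))

    Iβ-agree : ∀ {ν μ} → Agree (I (α −ᶠ β)) ν μ → Agree (I β) ν μ
    Iβ-agree ag z i = ag z (inj₁ (inj₂ i))

    -- Since α writes only variables that β writes, a run of β matching the outcome on vars β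
    -- ends in the very valuation the run of α ends in.
    complete : ∀ D ν μ → Agree (I (α −ᶠ β)) ν μ → Outcome (α −ᶠ β) D ν μ → D ⊢ μ ⊨ formula
    complete D ν μ ag (ν₂ , (r , ¬r) , ν₂≈μ) =
      completeα D ν μ (Iα-agree ag) (ν₂ , r , λ z v → ν₂≈μ z (inj₁ v)) , μ⊭φβ
      where
      μ⊭φβ : ¬ D ⊢ μ ⊨ φβ
      μ⊭φβ μ⊨φβ = let ν₃ , r₃ , ν₃≈μ = soundβ D ν μ (Iβ-agree ag) μ⊨φβ
                  in ¬r (⟦⟧-respʳ-≗ β r₃ (ν₃≗ν₂ r₃ ν₃≈μ))
        where
        ν₃≗ν₂ : ∀ {ν₃} → ⟦ β ⟧ D ν ν₃ → Agree (vars β) ν₃ μ → ν₃ ≗ ν₂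
        ν₃≗ν₂ r₃ ν₃≈μ z with O? β z
        ... | yes oβ = trans (ν₃≈μ z (O⊆vars β z oβ)) (sym (ν₂≈μ z (inj₂ (O⊆vars β z oβ))))
        ... | no ¬oβ = trans (sym (frame β r₃ ¬oβ)) (frame α r (λ oα → ¬oβ (Oα⊆Oβ z oα)))

    sound : ∀ D ν μ → Agree (I (α −ᶠ β)) ν μ → D ⊢ μ ⊨ formula → Outcome (α −ᶠ β) D ν μ
    sound D ν μ ag (μ⊨φα , μ⊭φβ) =
      let ν₂ , r , ν₂≈μ = soundα D ν μ (Iα-agree ag) μ⊨φα
          ν₂≈μ-on-β = Agree-vars-extend α β r ν₂≈μ (λ z x → ag z (join⊇ʳ α β z x))
      in ν₂ , (r , λ rβ → μ⊭φβ (completeβ D ν μ (Iβ-agree ag) (ν₂ , rβ , ν₂≈μ-on-β))) , Agree-∪ ν₂≈μ ν₂≈μ-on-β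

    translation : Translation (α −ᶠ β)
    translation = record
      { formula = formula ; executable = executable
      ; FV-sound = λ z → Data.Sum.map (FV-soundα z) (FV-soundβ z)
      ; FV-complete = λ z → Data.Sum.map (FV-completeα z) (FV-completeβ z)
      ; length-bound = diff-length-bound (lengthᵠ φα) (lengthᵠ φβ) (length (outs α)) (length (outs β)) (lengthᶠ α) (lengthᶠ β) boundα boundβ ; complete = complete ; sound = sound }

  translate : ∀ (α : FLIF S) → IoDisjoint α → Translation α
  translate (atom R xs ys) _ = translate-atom R xs ys
  translate (eqv x y) _ = translate-eqv x y
  translate (eqc x c) _ = translate-eqc x c
  translate (asgv x y) _ = translate-asgv x y
  translate (asgc x c) _ = translate-asgc x c
  translate (α ⨾ β) (disj , dα , dβ) =
    Sequence.translation disj (IoDisjoint⇒Disj α dα) (IoDisjoint⇒Disj β dβ) (translate α dα) (translate β dβ)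
  translate (α ∪ᶠ β) (_ , dα , dβ) = Union.translation (translate α dα) (translate β dβ)
  translate (α −ᶠ β) (disj , dα , dβ) = Difference.translation disj (translate α dα) (translate β dβ)

  EvalFLIF⇔EvalFO : ∀ {α : FLIF S} (T : Translation α) → Disj α → ∀ D νin μ →
                    EvalFLIF α D νin μ ⇔ EvalFO (Translation.formula T) (I α) D νin μ
  EvalFLIF⇔EvalFO {α} T disj D νin μ = mk⇔ to from
    where
    open Translation T
    to : EvalFLIF α D νin μ → EvalFO formula (I α) D νin μ
    to (νin′ , νout , νin≈νin′ , r , νout≈μ) =
      (λ z i → trans (νin≈νin′ z i) (νin′≈μ z i)) , complete D νin′ μ νin′≈μ (νout , r , νout≈μ)
      where
      νin′≈μ : Agree (I α) νin′ μ
      νin′≈μ z i = trans (frame α r (λ o → disj z (i , o))) (νout≈μ z (I⊆vars α z i))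
    from : EvalFO formula (I α) D νin μ → EvalFLIF α D νin μ
    from (νin≈μ , μ⊨φ) = let νout , r , νout≈μ = sound D μ μ (λ _ _ → refl) μ⊨φ
                         in μ , νout , νin≈μ , r , νout≈μ

theorem5p4 : Σ ℕ λ k → (S : Schema) (α : FLIF S) → IoDisjoint α →
               Σ (FO S) λ φ →
                 Exec (I α) φ × (FV φ ≐ vars α) × (lengthᵠ φ ≤ k * lengthᶠ α) ×
                 ((D : Instance S) (νin μ : Val) →
                   EvalFLIF α D νin μ ⇔ EvalFO φ (I α) D νin μ)
theorem5p4 = 3 , λ S α io-disjoint →
  let T = translate α io-disjoint
      open Translation T
  in formula , executable , (FV-sound , FV-complete) ,
     ≤-trans (m≤m+n (lengthᵠ formula) _) length-bound ,
     EvalFLIF⇔EvalFO T (IoDisjoint⇒Disj α io-disjoint)
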